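{- Let $\mathcal D$ be a complete non-empty diagram of height $r$, let $C$ be its strongly extremal column, let $\mathcal D^+$ be the diagram obtained by adding one block on top of $C$, and let $C^+$ be the resulting column. If $r$ is even (resp. odd), then the completion $\widehat{\mathcal D^+}$ of $\mathcal D^+$ is obtained from $\mathcal D^+$ by adjoining a (vertical) domino, i.e. two blocks, to every column strictly to the right (resp. left) of $C^+$.
   Context: A diagram of order $t+1$ is a tuple $(h_1,\dots,h_{t+1})$ of non-negative integers, pictured as columns $C_1,\dots,C_{t+1}$ of unit blocks ($C_i$ of height $h_i$); its height is $\max_ih_i$. Two distinct columns of height $\ge s$ are neighbours at level $s$ if every column strictly between them has height $<s$. A column is left (resp. right) extremal if it has no neighbour to its left (resp. right) at level equal to its height. Boundary conditions (always imposed): every left extremal column has even height or maximal height; every right extremal column has odd height or maximal height. The strongly extremal column of a non-empty diagram of height $r$ is the leftmost column of height $r$ if $r$ is odd and the rightmost column of height $r$ if $r$ is even (adding one block to it preserves the boundary conditions). Adjoining a domino: adding two blocks on top of a column of height $i$; even/odd as $i$ is even/odd; left (resp. right) if in the new diagram the enlarged column is the left (resp. right) neighbour at levels $i+1,i+2$ of some column of height $\ge i+2$. A diagram is complete if no left even or right odd domino can be adjoined. The completion of a diagram is the unique complete diagram obtainable from it by successively adjoining left even or right odd dominoes. -}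

module Defs where

open import Data.Nat using (ℕ; suc; _+_; _≤_) renaming (_<_ to _<ℕ_)
open import Data.Nat.Divisibility using (_∣_)
open import Data.Fin using (Fin; _<_; _≟_; _<?_)
open import Data.Product using (Σ; ∃; _×_)
open import Data.Sum using (_⊎_)
open import Relation.Nullary using (¬_; yes; no)
open import Relation.Binary.PropositionalEquality using (_≡_)

-- A diagram with n columns: column i has height D i.
-- (A diagram of order t+1 is a  Diagram (suc t).)
Diagram : ℕ → Set
Diagram n = Fin n → ℕ

Even : ℕ → Set
Even m = 2 ∣ m

Odd : ℕ → Set
Odd m = ¬ (2 ∣ m)

HasHeight : ∀ {n} → Diagram n → ℕ → Set
HasHeight {n} D r = (∀ k → D k ≤ r) × (Σ (Fin n) λ k → D k ≡ r)

MaximalHeight : ∀ {n} → Diagram n → Fin n → Set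
MaximalHeight D i = ∀ k → D k ≤ D i

-- i and j (with i < j) are neighbours at level s: i is the left
-- neighbour of j (and j the right neighbour of i) at level s.
LeftNbr : ∀ {n} → Diagram n → ℕ → Fin n → Fin n → Set
LeftNbr D s i j =
  (i < j) × (s ≤ D i) × (s ≤ D j) × (∀ k → i < k → k < j → D k <ℕ s)

LeftExtremal : ∀ {n} → Diagram n → Fin n → Set
LeftExtremal D i = ¬ (∃ λ j → LeftNbr D (D i) j i)

RightExtremal : ∀ {n} → Diagram n → Fin n → Set
RightExtremal D i = ¬ (∃ λ j → LeftNbr D (D i) i j)

BoundaryConditions : ∀ {n} → Diagram n → Set
BoundaryConditions D =
  (∀ i → LeftExtremal D i → Even (D i) ⊎ MaximalHeight D i) ×
  (∀ i → RightExtremal D i → Odd (D i) ⊎ MaximalHeight D i)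

StronglyExtremal : ∀ {n} → Diagram n → ℕ → Fin n → Set
StronglyExtremal D r c =
  (D c ≡ r) ×
  (Odd r → ∀ k → k < c → ¬ (D k ≡ r)) ×
  (Even r → ∀ k → c < k → ¬ (D k ≡ r))

addAt : ∀ {n} → Fin n → ℕ → Diagram n → Diagram n
addAt c m D k with k ≟ c
... | yes _ = D k + m
... | no _  = D k

dominoesRightOf : ∀ {n} → Fin n → Diagram n → Diagram n
dominoesRightOf c D k with c <? k
... | yes _ = D k + 2
... | no _  = D k

dominoesLeftOf : ∀ {n} → Fin n → Diagram n → Diagram n
dominoesLeftOf c D k with k <? c
... | yes _ = D k + 2
... | no _  = D k

LeftEvenAdjoinable : ∀ {n} → Diagram n → Fin n → Set
LeftEvenAdjoinable D j =
  Even (D j) × BoundaryConditions (addAt j 2 D) ×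
  (∃ λ m → LeftNbr (addAt j 2 D) (suc (D j)) j m
         × LeftNbr (addAt j 2 D) (suc (suc (D j))) j m)

RightOddAdjoinable : ∀ {n} → Diagram n → Fin n → Set
RightOddAdjoinable D j =
  Odd (D j) × BoundaryConditions (addAt j 2 D) ×
  (∃ λ m → LeftNbr (addAt j 2 D) (suc (D j)) m j
         × LeftNbr (addAt j 2 D) (suc (suc (D j))) m j)

Adjoinable : ∀ {n} → Diagram n → Fin n → Set
Adjoinable D j = LeftEvenAdjoinable D j ⊎ RightOddAdjoinable D j

Complete : ∀ {n} → Diagram n → Set
Complete D = ∀ j → ¬ Adjoinable D j

data Reach {n} : Diagram n → Diagram n → Set where
  done : ∀ {D E} → (∀ k → D k ≡ E k) → Reach D E
  step : ∀ {D E} j → Adjoinable D j → Reach (addAt j 2 D) E → Reach D E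

IsCompletion : ∀ {n} → Diagram n → Diagram n → Set
IsCompletion D X =
  Reach D X × Complete X ×
  (∀ E → Reach D E → Complete E → ∀ k → E k ≡ X k)

module Submission where

-- The two cases are mirror images (read the columns from right to left and
-- exchange even and odd), so the argument is made once, in module
-- `Diagrams`, for an arbitrary `Orientation` and `Parity`.  There a `Site`
-- is a column on which a domino can be adjoined, and the `Parent` of a
-- column is the nearest column one block higher on the side its parity
-- dictates.  `Diagrams.Completion` shows: columns beyond c have parents in
-- D; every site of a `Stage` (D⁺ with columns beyond c raised after their
-- parents) is an unraised column with ready parents, and a stage with an
-- unraised column has a site.  Hence the fully raised `Target` is reached
-- from D⁺ and is the only complete diagram reachable.

open import Defs
open import Data.Nat using (ℕ; zero; suc; _+_; _∸_; z≤n; s≤s; _<_; _≤_; _≤?_; _≟_)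
open import Data.Nat.Properties
  using (≤-refl; ≤-trans; ≤-reflexive; ≤-antisym; ≤-pred; <-irrefl; <⇒≱; ≰⇒>;
         n≤1+n; m≤m+n; ≤∧≢⇒<; suc-injective; m≢1+n+m;
         +-mono-≤; +-mono-<-≤; +-mono-≤-<; <-≤-trans; ∸-monoʳ-≤; n∸n≡0; m+n∸n≡m;
         +-comm; +-suc; +-monoʳ-≤; ∸-monoʳ-<)
open import Data.Nat.Divisibility using (_∣_; _∣?_; _∣0; ∣-refl; ∣m∣n⇒∣m+n; ∣m+n∣m⇒∣n; ∣1⇒≡1)
open import Data.Fin using (Fin; toℕ)
import Data.Fin as Fin
import Data.Fin.Properties as Fin
open import Data.Product using (Σ; _×_; _,_; proj₁; proj₂)
open import Data.Sum using (_⊎_; inj₁; inj₂) renaming (swap to ⊎-swap; map to ⊎-map)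
open import Data.Empty using (⊥; ⊥-elim)
open import Function using (flip; _∘_; id)
open import Relation.Nullary using (¬_; Dec; yes; no)
open import Relation.Nullary.Decidable using (_×-dec_)
open import Relation.Binary.Definitions using (Trichotomous; Transitive; Decidable; tri<; tri≈; tri>)
import Relation.Binary.Construct.Flip.EqAndOrd as Flip
open import Relation.Binary.PropositionalEquality

total : ∀ {m} → (Fin m → ℕ) → ℕ
total {zero} f = 0
total {suc m} f = f Fin.zero + total (f ∘ Fin.suc)

total-mono : ∀ {m} {f g : Fin m → ℕ} → (∀ k → f k ≤ g k) → total f ≤ total g
total-mono {zero} f≤g = z≤n
total-mono {suc m} f≤g = +-mono-≤ (f≤g Fin.zero) (total-mono (f≤g ∘ Fin.suc))

total-strict : ∀ {m} {f g : Fin m → ℕ} → (∀ k → f k ≤ g k) → ∀ j → f j < g j → total f < total g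
total-strict {suc m} f≤g Fin.zero f<g = +-mono-<-≤ f<g (total-mono (f≤g ∘ Fin.suc))
total-strict {suc m} f≤g (Fin.suc j) f<g = +-mono-≤-< (f≤g Fin.zero) (total-strict (f≤g ∘ Fin.suc) j f<g)

one-or-more : ∀ {a b} → suc a ≤ b → suc (suc a) ≤ b ⊎ b ≡ suc a
one-or-more {a} {b} a<b with suc (suc a) ≤? b
... | yes a+1<b = inj₁ a+1<b
... | no a+1≮b = inj₂ (≤-antisym (≤-pred (≰⇒> a+1≮b)) a<b)

not-raised : ∀ {h a} → h ≡ a → ¬ h ≡ suc (suc a)
not-raised {a = a} refl = m≢1+n+m a {1}

-- A strict total order on the columns together with a bounded rank that
-- it strictly increases; the rank makes every search along the order
-- terminate.
record Orientation (n : ℕ) : Set₁ where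
  field
    _≺_       : Fin n → Fin n → Set
    compare   : Trichotomous _≡_ _≺_
    ≺-trans   : Transitive _≺_
    rank      : Fin n → ℕ
    rank-mono : ∀ {a b} → a ≺ b → rank a < rank b
    rank<n    : ∀ a → rank a < n

ascending : ∀ n → Orientation n
ascending n = record
  { _≺_ = Fin._<_ ; compare = Fin.<-cmp ; ≺-trans = Fin.<-trans
  ; rank = toℕ ; rank-mono = λ a<b → a<b ; rank<n = Fin.toℕ<n }

reverse : ∀ {n} → Orientation n → Orientation n
reverse {n} O = record
  { _≺_ = flip _≺_ ; compare = Flip.compare _≺_ compare
  ; ≺-trans = λ b≺a c≺b → ≺-trans c≺b b≺a
  ; rank = λ a → n ∸ suc (rank a)
  ; rank-mono = λ {a} b≺a → ∸-monoʳ-< (s≤s (rank-mono b≺a)) (rank<n a)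
  ; rank<n = λ a → ∸-monoʳ-< (s≤s z≤n) (rank<n a) }
  where open Orientation O

module Order {n} (O : Orientation n) where
  open Orientation O public

  ≺-irrefl : ∀ {a} → ¬ a ≺ a
  ≺-irrefl a≺a = <-irrefl refl (rank-mono a≺a)

  ≺⇒≢ : ∀ {a b} → a ≺ b → a ≢ b
  ≺⇒≢ a≺b refl = ≺-irrefl a≺b

  ≺⇒≢˘ : ∀ {a b} → a ≺ b → b ≢ a
  ≺⇒≢˘ a≺b refl = ≺-irrefl a≺b

  ≺-asym : ∀ {a b} → a ≺ b → ¬ b ≺ a
  ≺-asym a≺b b≺a = ≺-irrefl (≺-trans a≺b b≺a)

  _≺?_ : Decidable _≺_
  a ≺? b with compare a b
  ... | tri< a≺b _ _ = yes a≺b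
  ... | tri≈ a⊀b _ _ = no a⊀b
  ... | tri> a⊀b _ _ = no a⊀b

  _≼_ : Fin n → Fin n → Set
  a ≼ b = a ≡ b ⊎ a ≺ b

  ≼-≺-trans : ∀ {a b c} → a ≼ b → b ≺ c → a ≺ c
  ≼-≺-trans (inj₁ refl) b≺c = b≺c
  ≼-≺-trans (inj₂ a≺b) b≺c = ≺-trans a≺b b≺c

  ≺-≼-trans : ∀ {a b c} → a ≺ b → b ≼ c → a ≺ c
  ≺-≼-trans a≺b (inj₁ refl) = a≺b
  ≺-≼-trans a≺b (inj₂ b≺c) = ≺-trans a≺b b≺c

module MaximalSearch {n} (O : Orientation n) where
  open Order O

  maximal : (P : Fin n → Set) → (∀ q → Dec (P q)) → ∀ {k} → P k →
            Σ (Fin n) λ j → k ≼ j × P j × (∀ q → j ≺ q → ¬ P q)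
  maximal P P? {k} Pk = search n (m≤m+n n (rank k)) Pk
    where
    search : ∀ fuel {k} → n ≤ fuel + rank k → P k →
             Σ (Fin n) λ j → k ≼ j × P j × (∀ q → j ≺ q → ¬ P q)
    search fuel {k} bound Pk with Fin.any? (λ q → (k ≺? q) ×-dec P? q)
    ... | no none = k , inj₁ refl , Pk , λ q k≺q Pq → none (q , k≺q , Pq)
    search zero {k} bound Pk | yes _ = ⊥-elim (<⇒≱ (rank<n k) bound)
    search (suc fuel) {k} bound Pk | yes (q , k≺q , Pq)
      with search fuel {q} (≤-trans bound (≤-trans (≤-reflexive (sym (+-suc fuel (rank k))))
                                                    (+-monoʳ-≤ fuel (rank-mono k≺q)))) Pq
    ... | j , q≼j , Pj , top = j , inj₂ (≺-≼-trans k≺q q≼j) , Pj , top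

module Nearest {n} (O : Orientation n) where
  open Order O
  open MaximalSearch O using (maximal)
  private module Downwards = MaximalSearch (reverse O)

  nearest-below : ∀ (X : Diagram n) s {i k} → k ≺ i → s ≤ X k →
    Σ (Fin n) λ j → k ≼ j × j ≺ i × s ≤ X j × (∀ q → j ≺ q → q ≺ i → X q < s)
  nearest-below X s {i} k≺i s≤Xk
    with maximal (λ q → q ≺ i × s ≤ X q) (λ q → (q ≺? i) ×-dec (s ≤? X q)) (k≺i , s≤Xk)
  ... | j , k≼j , (j≺i , s≤Xj) , top =
    j , k≼j , j≺i , s≤Xj , λ q j≺q q≺i → ≰⇒> (λ s≤Xq → top q j≺q (q≺i , s≤Xq))

  nearest-above : ∀ (X : Diagram n) s {i k} → i ≺ k → s ≤ X k →
    Σ (Fin n) λ j → i ≺ j × j ≼ k × s ≤ X j × (∀ q → i ≺ q → q ≺ j → X q < s)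
  nearest-above X s {i} i≺k s≤Xk
    with Downwards.maximal (λ q → i ≺ q × s ≤ X q) (λ q → (i ≺? q) ×-dec (s ≤? X q)) (i≺k , s≤Xk)
  ... | j , k≽j , (i≺j , s≤Xj) , bottom =
    j , i≺j , flip≽ k≽j , s≤Xj , λ q i≺q q≺j → ≰⇒> (λ s≤Xq → bottom q q≺j (i≺q , s≤Xq))
    where
    flip≽ : ∀ {k j} → k ≡ j ⊎ j ≺ k → j ≼ k
    flip≽ (inj₁ k≡j) = inj₁ (sym k≡j)
    flip≽ (inj₂ j≺k) = inj₂ j≺k

  last-reaching : ∀ (X : Diagram n) s {k} → s ≤ X k →
    Σ (Fin n) λ i → k ≼ i × s ≤ X i × (∀ q → i ≺ q → X q < s)
  last-reaching X s s≤Xk with maximal (λ q → s ≤ X q) (λ q → s ≤? X q) s≤Xk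
  ... | i , k≼i , s≤Xi , top = i , k≼i , s≤Xi , λ q i≺q → ≰⇒> (top q i≺q)

-- The parity demanded of a column that is extremal towards the lower end
-- of the orientation, and the complementary one demanded towards the upper
-- end.
record Parity : Set₁ where
  field
    Lower Upper    : ℕ → Set
    lower-or-upper : ∀ m → Lower m ⊎ Upper m
    not-both       : ∀ {m} → Lower m → ¬ Upper m
    lower-suc      : ∀ {m} → Lower (suc m) → Upper m
    upper-suc      : ∀ {m} → Upper (suc m) → Lower m

  lower+2 : ∀ {m} → Lower m → Lower (suc (suc m))
  lower+2 {m} l with lower-or-upper (suc (suc m))
  ... | inj₁ l′ = l′
  ... | inj₂ u = ⊥-elim (not-both l (lower-suc (upper-suc u)))

  upper+2 : ∀ {m} → Upper m → Upper (suc (suc m))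
  upper+2 {m} u with lower-or-upper (suc (suc m))
  ... | inj₁ l = ⊥-elim (not-both (upper-suc (lower-suc l)) u)
  ... | inj₂ u′ = u′

swap : Parity → Parity
swap P = record
  { Lower = Upper ; Upper = Lower ; lower-or-upper = λ m → ⊎-swap (lower-or-upper m)
  ; not-both = λ u l → not-both l u ; lower-suc = upper-suc ; upper-suc = lower-suc }
  where open Parity P

even+2 : ∀ {m} → Even m → Even (suc (suc m))
even+2 = ∣m∣n⇒∣m+n ∣-refl

¬even-1 : ¬ Even 1
¬even-1 2∣1 with ∣1⇒≡1 2∣1
... | ()

even-or-even-suc : ∀ m → Even m ⊎ Even (suc m)
even-or-even-suc zero = inj₁ (2 ∣0)
even-or-even-suc (suc m) with even-or-even-suc m
... | inj₁ e = inj₂ (even+2 e)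
... | inj₂ e = inj₁ e

evenLower : Parity
evenLower = record
  { Lower = Even ; Upper = Odd
  ; lower-or-upper = λ m → even-or-odd m
  ; not-both = λ e o → o e
  ; lower-suc = λ {m} e+1 e → ¬even-1 (∣m+n∣m⇒∣n (subst (2 ∣_) (+-comm 1 m) e+1) e)
  ; upper-suc = odd-suc }
  where
  even-or-odd : ∀ m → Even m ⊎ Odd m
  even-or-odd m with 2 ∣? m
  ... | yes e = inj₁ e
  ... | no o = inj₂ o
  odd-suc : ∀ {m} → Odd (suc m) → Even m
  odd-suc {m} o with even-or-even-suc m
  ... | inj₁ e = e
  ... | inj₂ e = ⊥-elim (o e)

-- Case distinction on equality of columns that, unlike a `with` on
-- `Fin._≟_`, does not abstract the comparison inside `addAt`.
same-or-other : ∀ {n} (k j : Fin n) → k ≡ j ⊎ k ≢ j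
same-or-other k j with k Fin.≟ j
... | yes k≡j = inj₁ k≡j
... | no k≢j = inj₂ k≢j

module _ {n} (j : Fin n) (m : ℕ) (X : Diagram n) where

  addAt-here : addAt j m X j ≡ X j + m
  addAt-here with j Fin.≟ j
  ... | yes _ = refl
  ... | no j≢j = ⊥-elim (j≢j refl)

  addAt-elsewhere : ∀ {k} → k ≢ j → addAt j m X k ≡ X k
  addAt-elsewhere {k} k≢j with k Fin.≟ j
  ... | yes k≡j = ⊥-elim (k≢j k≡j)
  ... | no _ = refl

  addAt-≥ : ∀ k → X k ≤ addAt j m X k
  addAt-≥ k with k Fin.≟ j
  ... | yes _ = m≤m+n (X k) m
  ... | no _ = ≤-refl

domino-here : ∀ {n} j (X : Diagram n) → addAt j 2 X j ≡ suc (suc (X j))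
domino-here j X = trans (addAt-here j 2 X) (+-comm (X j) 2)

-- The notions of the paper relative to an orientation and a parity: the
-- lower end of the orientation plays the role of the left end, and the
-- lower parity that of even heights.
module Diagrams {n} (O : Orientation n) (P : Parity) where
  open Order O public
  open Parity P public

  Between : Diagram n → Fin n → Fin n → ℕ → Set
  Between X a b h = ∀ q → a ≺ q → q ≺ b → X q ≤ h

  LowerExtremal UpperExtremal : Diagram n → Fin n → Set
  LowerExtremal X i = ∀ k → k ≺ i → X k < X i
  UpperExtremal X i = ∀ k → i ≺ k → X k < X i

  Boundary : Diagram n → Set
  Boundary X =
    (∀ i → LowerExtremal X i → Lower (X i) ⊎ MaximalHeight X i) ×
    (∀ i → UpperExtremal X i → Upper (X i) ⊎ MaximalHeight X i)

  Site : Diagram n → Fin n → Set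
  Site X j =
    (Upper (X j) × Σ (Fin n) λ m → m ≺ j × suc (suc (X j)) ≤ X m × Between X m j (X j)) ⊎
    (Lower (X j) × Σ (Fin n) λ m → j ≺ m × suc (suc (X j)) ≤ X m × Between X j m (X j))

  Parent : Diagram n → Fin n → Fin n → Set
  Parent X k p =
    (Upper (X k) × p ≺ k × X p ≡ suc (X k) × Between X p k (X k)) ⊎
    (Lower (X k) × k ≺ p × X p ≡ suc (X k) × Between X k p (X k))

  below⇒between : ∀ {X a b h} → (∀ q → a ≺ q → q ≺ b → X q < suc h) → Between X a b h
  below⇒between below q a≺q q≺b = ≤-pred (below q a≺q q≺b)

  parent-height : ∀ {X k p} → Parent X k p → X p ≡ suc (X k)
  parent-height (inj₁ (_ , _ , eq , _)) = eq
  parent-height (inj₂ (_ , _ , eq , _)) = eq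

  site-witness : ∀ {X j} → Site X j → Σ (Fin n) λ m → m ≢ j × suc (suc (X j)) ≤ X m
  site-witness (inj₁ (_ , m , m≺j , high , _)) = m , ≺⇒≢ m≺j , high
  site-witness (inj₂ (_ , m , j≺m , high , _)) = m , ≺⇒≢˘ j≺m , high

  lower-extremal-mono : ∀ {X Y i} → (∀ k → X k ≤ Y k) → X i ≡ Y i →
                        LowerExtremal Y i → LowerExtremal X i
  lower-extremal-mono X≤Y eq ext k k≺i =
    ≤-trans (s≤s (X≤Y k)) (≤-trans (ext k k≺i) (≤-reflexive (sym eq)))

  upper-extremal-mono : ∀ {X Y i} → (∀ k → X k ≤ Y k) → X i ≡ Y i →
                        UpperExtremal Y i → UpperExtremal X i
  upper-extremal-mono X≤Y eq ext k i≺k =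
    ≤-trans (s≤s (X≤Y k)) (≤-trans (ext k i≺k) (≤-reflexive (sym eq)))

  module _ {X : Diagram n} {j : Fin n} where
    private
      Y : Diagram n
      Y = addAt j 2 X

    maximal-stays : Site X j → ∀ {i} → i ≢ j → MaximalHeight X i → MaximalHeight Y i
    maximal-stays site {i} i≢j max k with same-or-other k j
    ... | inj₁ refl with site-witness site
    ...   | m , _ , high =
      subst₂ _≤_ (sym (domino-here k X)) (sym (addAt-elsewhere k 2 X i≢j)) (≤-trans high (max m))
    maximal-stays site {i} i≢j max k | inj₂ k≢j =
      subst₂ _≤_ (sym (addAt-elsewhere j 2 X k≢j)) (sym (addAt-elsewhere j 2 X i≢j)) (max k)

    -- the site's own column: the higher witness rules out the wrong side
    lower-extremal-site : Site X j → LowerExtremal Y j → Lower (Y j)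
    lower-extremal-site (inj₁ (_ , m , m≺j , high , _)) ext =
      ⊥-elim (<⇒≱ (ext m m≺j)
        (subst₂ _≤_ (sym (domino-here j X)) (sym (addAt-elsewhere j 2 X (≺⇒≢ m≺j))) high))
    lower-extremal-site (inj₂ (lower , _)) ext = subst Lower (sym (domino-here j X)) (lower+2 lower)

    upper-extremal-site : Site X j → UpperExtremal Y j → Upper (Y j)
    upper-extremal-site (inj₂ (_ , m , j≺m , high , _)) ext =
      ⊥-elim (<⇒≱ (ext m j≺m)
        (subst₂ _≤_ (sym (domino-here j X)) (sym (addAt-elsewhere j 2 X (≺⇒≢˘ j≺m))) high))
    upper-extremal-site (inj₁ (upper , _)) ext = subst Upper (sym (domino-here j X)) (upper+2 upper)

    boundary-adjoin : Site X j → Boundary X → Boundary Y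
    boundary-adjoin site (lowerBC , upperBC) = lowerBC′ , upperBC′
      where
      lowerBC′ : ∀ i → LowerExtremal Y i → Lower (Y i) ⊎ MaximalHeight Y i
      lowerBC′ i ext with same-or-other i j
      ... | inj₁ refl = inj₁ (lower-extremal-site site ext)
      ... | inj₂ i≢j = ⊎-map (subst Lower (sym same)) (maximal-stays site i≢j)
                           (lowerBC i (lower-extremal-mono (addAt-≥ j 2 X) (sym same) ext))
        where
        same : Y i ≡ X i
        same = addAt-elsewhere j 2 X i≢j
      upperBC′ : ∀ i → UpperExtremal Y i → Upper (Y i) ⊎ MaximalHeight Y i
      upperBC′ i ext with same-or-other i j
      ... | inj₁ refl = inj₁ (upper-extremal-site site ext)
      ... | inj₂ i≢j = ⊎-map (subst Upper (sym same)) (maximal-stays site i≢j)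
                           (upperBC i (upper-extremal-mono (addAt-≥ j 2 X) (sym same) ext))
        where
        same : Y i ≡ X i
        same = addAt-elsewhere j 2 X i≢j

  boundary-≗ : ∀ {E F} → (∀ k → E k ≡ F k) → Boundary E → Boundary F
  boundary-≗ {E} {F} E≗F (lowerBC , upperBC) =
    (λ i ext → ⊎-map (subst Lower (E≗F i)) max
                 (lowerBC i (lower-extremal-mono (≤-reflexive ∘ E≗F) (E≗F i) ext))) ,
    (λ i ext → ⊎-map (subst Upper (E≗F i)) max
                 (upperBC i (upper-extremal-mono (≤-reflexive ∘ E≗F) (E≗F i) ext)))
    where
    max : ∀ {i} → MaximalHeight E i → MaximalHeight F i
    max {i} m k = subst₂ _≤_ (E≗F k) (E≗F i) (m k)

  record Faithful : Set where
    field
      boundary⁺ : ∀ {X} → BoundaryConditions X → Boundary X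
      boundary⁻ : ∀ {X} → Boundary X → BoundaryConditions X
      site⁺     : ∀ {X j} → Adjoinable X j → Site X j
      site⁻     : ∀ {X j} → Site X j → BoundaryConditions (addAt j 2 X) → Adjoinable X j

  -- The completion of D⁺ = addAt c 1 D, for a complete diagram D of height
  -- r whose column c is the last one of height r, r having lower parity.
  -- "Beyond c" means above c in the orientation.
  module Completion (faithful : Faithful) (D : Diagram n) (r : ℕ) (c : Fin n)
    (D-c : D c ≡ r) (D≤r : ∀ k → D k ≤ r) (c-last : ∀ k → c ≺ k → D k ≢ r)
    (r-lower : Lower r) (bc-D : BoundaryConditions D) (complete-D : Complete D) where
    open Faithful faithful
    open Nearest O

    adjoinable : ∀ {X j} → Boundary X → Site X j → Adjoinable X j
    adjoinable bX site = site⁻ site (boundary⁻ (boundary-adjoin site bX))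

    boundary-D : Boundary D
    boundary-D = boundary⁺ bc-D

    no-site-D : ∀ j → ¬ Site D j
    no-site-D j site = complete-D j (adjoinable boundary-D site)

    beyond-c : ∀ {k} → c ≺ k → D k < r
    beyond-c {k} c≺k = ≤∧≢⇒< (D≤r k) (c-last k c≺k)

    D⁺ : Diagram n
    D⁺ = addAt c 1 D

    D⁺-c : D⁺ c ≡ suc r
    D⁺-c = trans (addAt-here c 1 D) (trans (+-comm (D c) 1) (cong suc D-c))

    -- Every column beyond c has a parent in D: otherwise either a domino
    -- could be adjoined to D, or the column would violate the boundary
    -- conditions.
    parent-exists : ∀ {k} → c ≺ k → Σ (Fin n) (Parent D k)
    parent-exists {k} c≺k with lower-or-upper (D k)
    ... | inj₂ upper with nearest-below D (suc (D k)) c≺k (subst (suc (D k) ≤_) (sym D-c) (beyond-c c≺k))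
    ...   | p , _ , p≺k , reach , btw with one-or-more reach
    ...     | inj₁ high = ⊥-elim (no-site-D k (inj₁ (upper , p , p≺k , high , below⇒between btw)))
    ...     | inj₂ exact = p , inj₁ (upper , p≺k , exact , below⇒between btw)
    parent-exists {k} c≺k | inj₁ lower with Fin.any? (λ q → (k ≺? q) ×-dec (suc (D k) ≤? D q))
    ... | yes (q , k≺q , reach-q) with nearest-above D (suc (D k)) k≺q reach-q
    ...   | p , k≺p , _ , reach , btw with one-or-more reach
    ...     | inj₁ high = ⊥-elim (no-site-D k (inj₂ (lower , p , k≺p , high , below⇒between btw)))
    ...     | inj₂ exact = p , inj₂ (lower , k≺p , exact , below⇒between btw)
    parent-exists {k} c≺k | inj₁ lower | no nothing-above =
      ⊥-elim (last-violates (last-reaching D (D k) ≤-refl))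
      where
      not-higher : ∀ {i} → k ≼ i → D i ≤ D k
      not-higher (inj₁ refl) = ≤-refl
      not-higher {i} (inj₂ k≺i) = ≤-pred (≰⇒> (λ above → nothing-above (i , k≺i , above)))

      -- the last column i reaching D k has height D k and is upper
      -- extremal, hence of upper parity or maximal; neither is possible
      last-violates : Σ (Fin n) (λ i → k ≼ i × D k ≤ D i × (∀ q → i ≺ q → D q < D k)) → ⊥
      last-violates (i , k≼i , reach , top)
        with boundary-D .proj₂ i (λ q i≺q → ≤-trans (top q i≺q) reach)
      ... | inj₁ upper = not-both lower (subst Upper (≤-antisym (not-higher k≼i) reach) upper)
      ... | inj₂ max =
        <⇒≱ (beyond-c c≺k) (≤-trans (≤-reflexive (sym D-c)) (≤-trans (max c) (not-higher k≼i)))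

    -- The parent of a column beyond c is c itself or lies beyond c, since
    -- c is higher than any column beyond it.
    parent-side : ∀ {k p} → c ≺ k → Parent D k p → c ≼ p
    parent-side {k} {p} c≺k (inj₁ (_ , p≺k , _ , btw)) with compare p c
    ... | tri< p≺c _ _ = ⊥-elim (<⇒≱ (beyond-c c≺k) (≤-trans (≤-reflexive (sym D-c)) (btw c p≺c c≺k)))
    ... | tri≈ _ p≡c _ = inj₁ (sym p≡c)
    ... | tri> _ _ c≺p = inj₂ c≺p
    parent-side c≺k (inj₂ (_ , k≺p , _)) = inj₂ (≺-trans c≺k k≺p)

    Raised : Diagram n → Fin n → Set
    Raised E p = c ≺ p × E p ≡ suc (suc (D p))

    Settled : Diagram n → Fin n → Set
    Settled E p = p ≡ c ⊎ Raised E p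

    ParentsReady : Diagram n → Fin n → Set
    ParentsReady E k = ∀ p → Parent D k p → Settled E p

    Frontier : Diagram n → Fin n → Set
    Frontier E k = c ≺ k × E k ≡ D k × Σ (Fin n) λ p → Parent D k p × Settled E p

    -- E is a stage on the way from D⁺ to its completion: every column is
    -- as in D⁺, or has been raised after its parents.
    Stage : Diagram n → Set
    Stage E = ∀ k → E k ≡ D⁺ k ⊎ (Raised E k × ParentsReady E k)

    module _ {E : Diagram n} (stage : Stage E) where

      stage-c : E c ≡ suc r
      stage-c with stage c
      ... | inj₁ eq = trans eq D⁺-c
      ... | inj₂ ((c≺c , _) , _) = ⊥-elim (≺-irrefl c≺c)

      stage-below : ∀ {k} → k ≺ c → E k ≡ D k
      stage-below {k} k≺c with stage k
      ... | inj₁ eq = trans eq (addAt-elsewhere c 1 D (≺⇒≢ k≺c))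
      ... | inj₂ ((c≺k , _) , _) = ⊥-elim (≺-asym k≺c c≺k)

      stage-beyond : ∀ {k} → c ≺ k → E k ≡ D k ⊎ (Raised E k × ParentsReady E k)
      stage-beyond {k} c≺k with stage k
      ... | inj₁ eq = inj₁ (trans eq (addAt-elsewhere c 1 D (≺⇒≢˘ c≺k)))
      ... | inj₂ raised = inj₂ raised

      stage-≤+2 : ∀ k → E k ≤ suc (suc (D k))
      stage-≤+2 k with same-or-other k c | stage k
      ... | inj₁ refl | _ = ≤-trans (≤-reflexive (trans stage-c (cong suc (sym D-c)))) (n≤1+n _)
      ... | inj₂ k≢c | inj₁ eq =
        ≤-trans (≤-reflexive (trans eq (addAt-elsewhere c 1 D k≢c))) (≤-trans (n≤1+n _) (n≤1+n _))
      ... | inj₂ _ | inj₂ ((_ , eq) , _) = ≤-reflexive eq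

      stage-≤r+1 : ∀ k → E k ≤ suc r
      stage-≤r+1 k with same-or-other k c | stage k
      ... | inj₁ refl | _ = ≤-reflexive stage-c
      ... | inj₂ k≢c | inj₁ eq =
        ≤-trans (≤-reflexive (trans eq (addAt-elsewhere c 1 D k≢c))) (≤-trans (D≤r k) (n≤1+n r))
      ... | inj₂ _ | inj₂ ((c≺k , eq) , _) = ≤-trans (≤-reflexive eq) (s≤s (beyond-c c≺k))

      between-below : ∀ {a b h} → b ≼ c → Between E a b h → Between D a b h
      between-below b≼c btw q a≺q q≺b = subst (_≤ _) (stage-below (≺-≼-trans q≺b b≼c)) (btw q a≺q q≺b)

      -- No site lies below c: it would be a site of D, except when its
      -- higher column is c, where r = D j + 1 contradicts the parities.
      no-site-below : ∀ {j} → j ≺ c → ¬ Site E j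
      no-site-below {j} j≺c (inj₁ (upper , m , m≺j , high , btw)) =
        no-site-D j (inj₁ (subst Upper Ej upper , m , m≺j ,
          subst₂ (λ a b → suc (suc a) ≤ b) Ej (stage-below (≺-trans m≺j j≺c)) high ,
          subst (Between D m j) Ej (between-below (inj₂ j≺c) btw)))
        where
        Ej : E j ≡ D j
        Ej = stage-below j≺c
      no-site-below {j} j≺c (inj₂ (lower , m , j≺m , high , btw)) with compare m c
      ... | tri< m≺c _ _ =
        no-site-D j (inj₂ (subst Lower Ej lower , m , j≺m ,
          subst₂ (λ a b → suc (suc a) ≤ b) Ej (stage-below m≺c) high ,
          subst (Between D j m) Ej (between-below (inj₂ m≺c) btw)))
        where
        Ej : E j ≡ D j
        Ej = stage-below j≺c
      ... | tri> _ _ c≺m =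
        <⇒≱ (s≤s (≤-trans (≤-reflexive (stage-below j≺c)) (D≤r j))) (subst (_≤ E j) stage-c (btw c j≺c c≺m))
      ... | tri≈ _ refl _
        with one-or-more (≤-pred (subst₂ (λ a b → suc (suc a) ≤ b) (stage-below j≺c) stage-c high))
      ...   | inj₁ high′ =
        no-site-D j (inj₂ (subst Lower Ej lower , c , j≺c , subst (suc (suc (D j)) ≤_) (sym D-c) high′ ,
          subst (Between D j c) Ej (between-below (inj₁ refl) btw)))
        where
        Ej : E j ≡ D j
        Ej = stage-below j≺c
      ...   | inj₂ r≡Dj+1 =
        not-both (subst Lower (stage-below j≺c) lower) (lower-suc (subst Lower r≡Dj+1 r-lower))

      -- c is not a site: it is the highest column of E.
      no-site-at-c : ¬ Site E c
      no-site-at-c site with site-witness site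
      ... | m , _ , high = <⇒≱ (subst (λ h → suc (suc h) ≤ E m) stage-c high) (≤-trans (stage-≤r+1 m) (n≤1+n _))

      -- A raised column is not a site: its parent p (c or raised) lies on the
      -- side of the site's higher column m, and blocks it.
      no-site-raised : ∀ {j} → Raised E j → ParentsReady E j → ¬ Site E j
      no-site-raised {j} (c≺j , Ej) ready site with parent-exists c≺j
      ... | p , parent = blocked parent site (ready p parent)
        where
        too-high : ∀ {m} → suc (suc (E j)) ≤ E m → ¬ E m ≤ suc (suc (suc (D j)))
        too-high {m} high = <⇒≱ (subst (λ h → suc (suc h) ≤ E m) Ej high)

        raised-parent : Raised E p → E p ≡ suc (suc (suc (D j)))
        raised-parent (_ , Ep) = trans Ep (cong (suc ∘ suc) (parent-height parent))

        c-parent : p ≡ c → ∀ m → E m ≤ suc (suc (suc (D j)))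
        c-parent refl m = ≤-trans (stage-≤r+1 m)
          (≤-trans (≤-reflexive (cong suc (trans (sym D-c) (parent-height parent)))) (n≤1+n _))

        blocked : Parent D j p → Site E j → Settled E p → ⊥
        blocked (inj₁ (upper , _)) (inj₂ (lower , _)) _ = not-both (subst Lower Ej lower) (upper+2 upper)
        blocked (inj₂ (lower , _)) (inj₁ (upper , _)) _ = not-both (lower+2 lower) (subst Upper Ej upper)
        blocked (inj₁ _) (inj₁ (_ , m , _ , high , _)) (inj₁ p≡c) = too-high high (c-parent p≡c m)
        blocked (inj₂ (_ , j≺p , _)) (inj₂ _) (inj₁ refl) = ≺-asym c≺j j≺p
        blocked (inj₁ (_ , p≺j , _ , btwD)) (inj₁ (_ , m , m≺j , high , btw)) (inj₂ raised)
          with compare m p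
        ... | tri≈ _ refl _ = too-high high (≤-reflexive (raised-parent raised))
        ... | tri< m≺p _ _ = <⇒≱ (≤-reflexive (sym (trans (raised-parent raised) (cong suc (sym Ej)))))
                                 (btw p m≺p p≺j)
        ... | tri> _ _ p≺m =
          too-high high (≤-trans (stage-≤+2 m) (s≤s (s≤s (≤-trans (btwD m p≺m m≺j) (n≤1+n _)))))
        blocked (inj₂ (_ , j≺p , _ , btwD)) (inj₂ (_ , m , j≺m , high , btw)) (inj₂ raised)
          with compare m p
        ... | tri≈ _ refl _ = too-high high (≤-reflexive (raised-parent raised))
        ... | tri> _ _ p≺m = <⇒≱ (≤-reflexive (sym (trans (raised-parent raised) (cong suc (sym Ej)))))
                                 (btw p j≺p p≺m)
        ... | tri< m≺p _ _ =
          too-high high (≤-trans (stage-≤+2 m) (s≤s (s≤s (≤-trans (btwD m j≺m m≺p) (n≤1+n _)))))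

      -- An unraised
      -- parent p beyond c would block the site's higher column m, or lie
      -- beyond m and then be a parent of m too, which contradicts m having
      -- been raised after its parents.
      unraised-site-ready : ∀ {j} → c ≺ j → E j ≡ D j → Site E j → ParentsReady E j
      unraised-site-ready {j} c≺j Ej site p parent with parent-side c≺j parent
      ... | inj₁ refl = inj₁ refl
      ... | inj₂ c≺p with stage-beyond c≺p
      ...   | inj₂ (raised , _) = inj₂ raised
      ...   | inj₁ Ep = ⊥-elim (blocked parent site)
        where
        Ep′ : E p ≡ suc (E j)
        Ep′ = trans Ep (trans (parent-height parent) (cong suc (sym Ej)))

        higher-raised : ∀ {m} → c ≺ m → suc (suc (E j)) ≤ E m → D m ≤ D j →
                        ParentsReady E m × D m ≡ D j
        higher-raised {m} c≺m high Dm≤Dj with stage-beyond c≺m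
        ... | inj₁ Em =
          ⊥-elim (<⇒≱ high (≤-trans (≤-reflexive Em) (≤-trans Dm≤Dj (≤-trans (≤-reflexive (sym Ej)) (n≤1+n _)))))
        ... | inj₂ ((_ , Em) , ready) =
          ready , ≤-antisym Dm≤Dj (≤-pred (≤-pred (subst₂ (λ a b → suc (suc a) ≤ b) Ej Em high)))

        -- p is neither c nor raised, so it is the parent of no raised column
        unready : ∀ {m} → Parent D m p → ¬ ParentsReady E m
        unready parent-m ready with ready p parent-m
        ... | inj₁ refl = ≺-irrefl c≺p
        ... | inj₂ (_ , Ep″) = <⇒≱ (≤-reflexive (sym (trans (sym Ep) Ep″))) (n≤1+n _)

        blocked : Parent D j p → Site E j → ⊥
        blocked (inj₁ (upper , _)) (inj₂ (lower , _)) = not-both (subst Lower Ej lower) upper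
        blocked (inj₂ (lower , _)) (inj₁ (upper , _)) = not-both lower (subst Upper Ej upper)
        blocked (inj₁ (upper , p≺j , Dp , btwD)) (inj₁ (_ , m , m≺j , high , btw)) with compare m p
        ... | tri≈ _ refl _ = <⇒≱ high (≤-reflexive Ep′)
        ... | tri< m≺p _ _ = <⇒≱ (≤-reflexive (sym Ep′)) (btw p m≺p p≺j)
        ... | tri> _ _ p≺m with higher-raised (≺-trans c≺p p≺m) high (btwD m p≺m m≺j)
        ...   | ready-m , Dm = unready (inj₁ (subst Upper (sym Dm) upper , p≺m , trans Dp (cong suc (sym Dm)) ,
                  λ q p≺q q≺m → subst (D q ≤_) (sym Dm) (btwD q p≺q (≺-trans q≺m m≺j)))) ready-m
        blocked (inj₂ (lower , j≺p , Dp , btwD)) (inj₂ (_ , m , j≺m , high , btw)) with compare m p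
        ... | tri≈ _ refl _ = <⇒≱ high (≤-reflexive Ep′)
        ... | tri> _ _ p≺m = <⇒≱ (≤-reflexive (sym Ep′)) (btw p j≺p p≺m)
        ... | tri< m≺p _ _ with higher-raised (≺-trans c≺j j≺m) high (btwD m j≺m m≺p)
        ...   | ready-m , Dm = unready (inj₂ (subst Lower (sym Dm) lower , m≺p , trans Dp (cong suc (sym Dm)) ,
                  λ q m≺q q≺p → subst (D q ≤_) (sym Dm) (btwD q (≺-trans j≺m m≺q) q≺p))) ready-m

      site-analysis : ∀ {j} → Site E j → c ≺ j × E j ≡ D j × ParentsReady E j
      site-analysis {j} site with compare j c
      ... | tri< j≺c _ _ = ⊥-elim (no-site-below j≺c site)
      ... | tri≈ _ refl _ = ⊥-elim (no-site-at-c site)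
      ... | tri> _ _ c≺j with stage-beyond c≺j
      ...   | inj₁ Ej = c≺j , Ej , unraised-site-ready c≺j Ej site
      ...   | inj₂ (raised , ready) = ⊥-elim (no-site-raised raised ready site)

    raised-stays : ∀ {E j p} → E j ≡ D j → Raised E p → Raised (addAt j 2 E) p
    raised-stays {E} {j} {p} Ej (c≺p , Ep) with same-or-other p j
    ... | inj₁ refl = ⊥-elim (<⇒≱ (≤-trans (n≤1+n _) (≤-reflexive (sym Ep))) (≤-reflexive Ej))
    ... | inj₂ p≢j = c≺p , trans (addAt-elsewhere j 2 E p≢j) Ep

    ready-stays : ∀ {E j k} → E j ≡ D j → ParentsReady E k → ParentsReady (addAt j 2 E) k
    ready-stays Ej ready p parent = ⊎-map id (raised-stays Ej) (ready p parent)

    stage-step : ∀ {E j} → Stage E → c ≺ j → E j ≡ D j → ParentsReady E j → Stage (addAt j 2 E)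
    stage-step {E} {j} stage c≺j Ej ready k with same-or-other k j
    ... | inj₁ refl = inj₂ ((c≺j , trans (domino-here k E) (cong (suc ∘ suc) Ej)) , ready-stays Ej ready)
    ... | inj₂ k≢j with stage k
    ...   | inj₁ eq = inj₁ (trans (addAt-elsewhere j 2 E k≢j) eq)
    ...   | inj₂ ((c≺k , eq) , ready-k) =
      inj₂ ((c≺k , trans (addAt-elsewhere j 2 E k≢j) eq) , ready-stays Ej ready-k)

    stage-≗ : ∀ {E F} → (∀ k → E k ≡ F k) → Stage E → Stage F
    stage-≗ {E} {F} E≗F stage k with stage k
    ... | inj₁ eq = inj₁ (trans (sym (E≗F k)) eq)
    ... | inj₂ (raised , ready) =
      inj₂ (raised-≗ raised , λ p parent → ⊎-map id raised-≗ (ready p parent))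
      where
      raised-≗ : ∀ {p} → Raised E p → Raised F p
      raised-≗ {p} (c≺p , Ep) = c≺p , trans (sym (E≗F p)) Ep

    module _ {E : Diagram n} (stage : Stage E) where

      -- Climbing along parents from an unraised column beyond c (heights
      -- grow and stay below r) reaches the frontier.
      reach-frontier : ∀ {k} → c ≺ k → E k ≡ D k → Σ (Fin n) (Frontier E)
      reach-frontier {k} = climb r (m≤m+n r (D k))
        where
        climb : ∀ fuel {k} → r ≤ fuel + D k → c ≺ k → E k ≡ D k → Σ (Fin n) (Frontier E)
        climb zero bound c≺k _ = ⊥-elim (<⇒≱ (beyond-c c≺k) bound)
        climb (suc fuel) {k} bound c≺k Ek with parent-exists c≺k
        ... | p , parent with parent-side c≺k parent
        ...   | inj₁ refl = k , c≺k , Ek , p , parent , inj₁ refl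
        ...   | inj₂ c≺p with stage-beyond stage c≺p
        ...     | inj₂ (raised , _) = k , c≺k , Ek , p , parent , inj₂ raised
        ...     | inj₁ Ep = climb fuel bound′ c≺p Ep
          where
          bound′ : r ≤ fuel + D p
          bound′ = subst (r ≤_) (trans (sym (+-suc fuel (D k))) (cong (fuel +_) (sym (parent-height parent))))
                         bound

      parent-high : ∀ {k p} → Parent D k p → Settled E p → suc (suc (D k)) ≤ E p
      parent-high parent (inj₁ refl) =
        ≤-reflexive (trans (cong suc (trans (sym (parent-height parent)) D-c)) (sym (stage-c stage)))
      parent-high parent (inj₂ (_ , Ep)) =
        ≤-trans (n≤1+n _) (≤-reflexive (sym (trans Ep (cong (suc ∘ suc) (parent-height parent)))))

      settled-side : ∀ {p} → Settled E p → c ≼ p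
      settled-side (inj₁ p≡c) = inj₁ (sym p≡c)
      settled-side (inj₂ (c≺p , _)) = inj₂ c≺p

      -- The nearest column i between its
      -- parent p and k reaching D k + 1 reaches D k + 2: otherwise i is a
      -- raised column with D i + 1 = D k, whose ready parent would lie
      -- between i and k or cover k.  (Here k has upper parity.)
      frontier-site-upper : ∀ {k p} → c ≺ k → E k ≡ D k → Upper (D k) → p ≺ k →
        D p ≡ suc (D k) → Between D p k (D k) → Settled E p → Site E k
      frontier-site-upper {k} {p} c≺k Ek upper p≺k Dp btwD settled
        with nearest-below E (suc (D k)) p≺k (≤-trans (n≤1+n _) p-high)
        where
        p-high : suc (suc (D k)) ≤ E p
        p-high = parent-high (inj₁ (upper , p≺k , Dp , btwD)) settled
      ... | i , p≼i , i≺k , reach , btw with one-or-more reach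
      ...   | inj₁ high = inj₁ (subst Upper (sym Ek) upper , i , i≺k ,
              subst (λ h → suc (suc h) ≤ E i) (sym Ek) high ,
              subst (Between E i k) (sym Ek) (below⇒between btw))
      ...   | inj₂ Ei = ⊥-elim (stops p≼i)
        where
        raised-i : c ≺ i → D k ≡ suc (D i) → ParentsReady E i → ⊥
        raised-i c≺i Dk ready-i with parent-exists c≺i
        ... | q , inj₁ (upper-i , _) = not-both (upper-suc (subst Upper Dk upper)) upper-i
        ... | q , parent-i@(inj₂ (_ , i≺q , Dq , btwq)) with ready-i q parent-i
        ...   | inj₁ refl = ≺-asym c≺i i≺q
        ...   | inj₂ (_ , Eq) with compare q k
        ...     | tri≈ _ refl _ = not-raised Ek Eq′
          where
          Eq′ : E q ≡ suc (suc (D k))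
          Eq′ = trans Eq (cong (suc ∘ suc) (trans Dq (sym Dk)))
        ...     | tri< q≺k _ _ = <⇒≱ (btw q i≺q q≺k) (≤-trans (n≤1+n _) (≤-reflexive (sym Eq′)))
          where
          Eq′ : E q ≡ suc (suc (D k))
          Eq′ = trans Eq (cong (suc ∘ suc) (trans Dq (sym Dk)))
        ...     | tri> _ _ k≺q = <⇒≱ (≤-reflexive (sym Dk)) (btwq k i≺k k≺q)

        stops : p ≼ i → ⊥
        stops (inj₁ refl) = <⇒≱ (parent-high (inj₁ (upper , p≺k , Dp , btwD)) settled) (≤-reflexive Ei)
        stops (inj₂ p≺i) with stage-beyond stage (≼-≺-trans (settled-side settled) p≺i)
        ... | inj₁ Ei′ = <⇒≱ (≤-reflexive (trans (sym Ei) Ei′)) (btwD i p≺i i≺k)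
        ... | inj₂ ((c≺i , Ei″) , ready-i) = raised-i c≺i (suc-injective (trans (sym Ei) Ei″)) ready-i

      -- The mirror image, for k of lower parity: its parent lies above k,
      -- so it is raised.
      frontier-site-lower : ∀ {k p} → c ≺ k → E k ≡ D k → Lower (D k) → k ≺ p →
        D p ≡ suc (D k) → Between D k p (D k) → Raised E p → Site E k
      frontier-site-lower {k} {p} c≺k Ek lower k≺p Dp btwD raised
        with nearest-above E (suc (D k)) k≺p (≤-trans (n≤1+n _) p-high)
        where
        p-high : suc (suc (D k)) ≤ E p
        p-high = parent-high (inj₂ (lower , k≺p , Dp , btwD)) (inj₂ raised)
      ... | i , k≺i , i≼p , reach , btw with one-or-more reach
      ...   | inj₁ high = inj₂ (subst Lower (sym Ek) lower , i , k≺i ,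
              subst (λ h → suc (suc h) ≤ E i) (sym Ek) high ,
              subst (Between E k i) (sym Ek) (below⇒between btw))
      ...   | inj₂ Ei = ⊥-elim (stops i≼p)
        where
        raised-i : c ≺ i → D k ≡ suc (D i) → ParentsReady E i → ⊥
        raised-i c≺i Dk ready-i with parent-exists c≺i
        ... | q , inj₂ (lower-i , _) = not-both lower-i (lower-suc (subst Lower Dk lower))
        ... | q , parent-i@(inj₁ (_ , q≺i , Dq , btwq)) with ready-i q parent-i
        ...   | inj₁ refl = <⇒≱ (beyond-c c≺k) (≤-reflexive (trans (sym D-c) (trans Dq (sym Dk))))
        ...   | inj₂ (_ , Eq) with compare q k
        ...     | tri≈ _ refl _ = not-raised Ek Eq′
          where
          Eq′ : E q ≡ suc (suc (D k))
          Eq′ = trans Eq (cong (suc ∘ suc) (trans Dq (sym Dk)))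
        ...     | tri> _ _ k≺q = <⇒≱ (btw q k≺q q≺i) (≤-trans (n≤1+n _) (≤-reflexive (sym Eq′)))
          where
          Eq′ : E q ≡ suc (suc (D k))
          Eq′ = trans Eq (cong (suc ∘ suc) (trans Dq (sym Dk)))
        ...     | tri< q≺k _ _ = <⇒≱ (≤-reflexive (sym Dk)) (btwq k q≺k k≺i)

        stops : i ≼ p → ⊥
        stops (inj₁ refl) = <⇒≱ (parent-high (inj₂ (lower , k≺p , Dp , btwD)) (inj₂ raised)) (≤-reflexive Ei)
        stops (inj₂ i≺p) with stage-beyond stage (≺-trans c≺k k≺i)
        ... | inj₁ Ei′ = <⇒≱ (≤-reflexive (trans (sym Ei) Ei′)) (btwD i k≺i i≺p)
        ... | inj₂ ((c≺i , Ei″) , ready-i) = raised-i c≺i (suc-injective (trans (sym Ei) Ei″)) ready-i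

      frontier-site : ∀ {k} → Frontier E k → Site E k
      frontier-site (c≺k , Ek , p , inj₁ (upper , p≺k , Dp , btwD) , settled) =
        frontier-site-upper c≺k Ek upper p≺k Dp btwD settled
      frontier-site (c≺k , Ek , p , inj₂ (_ , k≺p , _) , inj₁ refl) = ⊥-elim (≺-asym c≺k k≺p)
      frontier-site (c≺k , Ek , p , inj₂ (lower , k≺p , Dp , btwD) , inj₂ raised) =
        frontier-site-lower c≺k Ek lower k≺p Dp btwD raised

      progress : ∀ {k} → c ≺ k → E k ≡ D k → Σ (Fin n) (Site E)
      progress c≺k Ek with reach-frontier c≺k Ek
      ... | k′ , frontier = k′ , frontier-site frontier

    Target : Diagram n → Set
    Target X = ∀ k → (c ≺ k → X k ≡ suc (suc (D k))) × (¬ c ≺ k → X k ≡ D⁺ k)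

    target-unique : ∀ {X Y} → Target X → Target Y → ∀ k → X k ≡ Y k
    target-unique tX tY k with c ≺? k
    ... | yes c≺k = trans (tX k .proj₁ c≺k) (sym (tY k .proj₁ c≺k))
    ... | no c⊀k = trans (tX k .proj₂ c⊀k) (sym (tY k .proj₂ c⊀k))

    -- The target is a stage: parents of columns beyond c are c or lie
    -- beyond c, hence are raised.
    target-stage : ∀ {X} → Target X → Stage X
    target-stage {X} target k with c ≺? k
    ... | no c⊀k = inj₁ (target k .proj₂ c⊀k)
    ... | yes c≺k = inj₂ ((c≺k , target k .proj₁ c≺k) , ready)
      where
      ready : ParentsReady X k
      ready p parent with parent-side c≺k parent
      ... | inj₁ refl = inj₁ refl
      ... | inj₂ c≺p = inj₂ (c≺p , target p .proj₁ c≺p)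

    -- The target has no site: a site of a stage is unraised.
    target-complete : ∀ {X} → Target X → ∀ j → ¬ Site X j
    target-complete target j site with site-analysis (target-stage target) site
    ... | c≺j , Xj , _ = not-raised Xj (target j .proj₁ c≺j)

    stage-target : ∀ {E} → Stage E → (∀ k → c ≺ k → E k ≢ D k) → Target E
    stage-target {E} stage none k = beyond , not-beyond
      where
      beyond : c ≺ k → E k ≡ suc (suc (D k))
      beyond c≺k with stage-beyond stage c≺k
      ... | inj₁ Ek = ⊥-elim (none k c≺k Ek)
      ... | inj₂ ((_ , Ek) , _) = Ek
      not-beyond : ¬ c ≺ k → E k ≡ D⁺ k
      not-beyond c⊀k with stage k
      ... | inj₁ Ek = Ek
      ... | inj₂ ((c≺k , _) , _) = ⊥-elim (c⊀k c≺k)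

    D⁺-stage : Stage D⁺
    D⁺-stage k = inj₁ refl

    -- D⁺ satisfies the boundary conditions: c is its highest column, and a
    -- column that was maximal in D now is lower extremal of height r,
    -- which has lower parity, while it cannot be upper extremal.
    boundary-D⁺ : Boundary D⁺
    boundary-D⁺ = lowerBC , upperBC
      where
      D⁺-max : MaximalHeight D⁺ c
      D⁺-max k = ≤-trans (stage-≤r+1 D⁺-stage k) (≤-reflexive (sym D⁺-c))

      maximal-r : ∀ {i} → MaximalHeight D i → D i ≡ r
      maximal-r {i} max = ≤-antisym (D≤r i) (subst (_≤ D i) D-c (max c))

      lowerBC : ∀ i → LowerExtremal D⁺ i → Lower (D⁺ i) ⊎ MaximalHeight D⁺ i
      lowerBC i ext with same-or-other i c
      ... | inj₁ refl = inj₂ D⁺-max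
      ... | inj₂ i≢c = inj₁ (subst Lower (sym same)
                              (lower-D (boundary-D .proj₁ i (lower-extremal-mono (addAt-≥ c 1 D) (sym same) ext))))
        where
        same : D⁺ i ≡ D i
        same = addAt-elsewhere c 1 D i≢c
        lower-D : Lower (D i) ⊎ MaximalHeight D i → Lower (D i)
        lower-D (inj₁ lower) = lower
        lower-D (inj₂ max) = subst Lower (sym (maximal-r max)) r-lower

      upperBC : ∀ i → UpperExtremal D⁺ i → Upper (D⁺ i) ⊎ MaximalHeight D⁺ i
      upperBC i ext with same-or-other i c
      ... | inj₁ refl = inj₂ D⁺-max
      ... | inj₂ i≢c = inj₁ (subst Upper (sym same)
                              (upper-D (boundary-D .proj₂ i (upper-extremal-mono (addAt-≥ c 1 D) (sym same) ext))))
        where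
        same : D⁺ i ≡ D i
        same = addAt-elsewhere c 1 D i≢c
        upper-D : Upper (D i) ⊎ MaximalHeight D i → Upper (D i)
        upper-D (inj₁ upper) = upper
        upper-D (inj₂ max) with compare i c
        ... | tri< i≺c _ _ = ⊥-elim (<⇒≱ (ext c i≺c)
          (≤-trans (≤-reflexive (trans same (maximal-r max))) (subst (r ≤_) (sym D⁺-c) (n≤1+n r))))
        ... | tri≈ _ i≡c _ = ⊥-elim (i≢c i≡c)
        ... | tri> _ _ c≺i = ⊥-elim (c-last i c≺i (maximal-r max))

    deficit : Diagram n → Diagram n → ℕ
    deficit X E = total (λ k → X k ∸ E k)

    -- From a stage, the target is reached by adjoining dominoes at sites,
    -- each step lowering the deficit by two.
    build : ∀ fuel {X E} → Target X → Stage E → Boundary E → deficit X E < fuel → Reach E X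
    build zero _ _ _ ()
    build (suc fuel) {X} {E} target stage bE small with Fin.any? (λ k → (c ≺? k) ×-dec (E k ≟ D k))
    ... | no none = done (target-unique (stage-target stage (λ k c≺k Ek → none (k , c≺k , Ek))) target)
    ... | yes (k , c≺k , Ek) with progress stage c≺k Ek
    ...   | j , site with site-analysis stage site
    ...     | c≺j , Ej , ready =
      step j (adjoinable bE site)
        (build fuel target (stage-step stage c≺j Ej ready) (boundary-adjoin site bE)
               (<-≤-trans decrease (≤-pred small)))
      where
      decrease : deficit X (addAt j 2 E) < deficit X E
      decrease = total-strict (λ k → ∸-monoʳ-≤ (X k) (addAt-≥ j 2 E k)) j
                              (subst₂ _<_ (sym after) (sym before) (s≤s z≤n))
        where
        Xj : X j ≡ suc (suc (D j))
        Xj = target j .proj₁ c≺j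
        after : X j ∸ addAt j 2 E j ≡ 0
        after = trans (cong₂ _∸_ Xj (trans (domino-here j E) (cong (suc ∘ suc) Ej))) (n∸n≡0 (suc (suc (D j))))
        before : X j ∸ E j ≡ 2
        before = trans (cong₂ _∸_ Xj Ej) (m+n∸n≡m 2 (D j))

    -- Every complete diagram reachable from a stage is the target: the
    -- path only adjoins dominoes at sites, which keeps it among stages, and
    -- a complete stage has no unraised column beyond c by progress.
    reach-target : ∀ {E F} → Stage E → Boundary E → Reach E F → Complete F → Target F
    reach-target stage bE (step j adj rest) complete-F with site-analysis stage (site⁺ adj)
    ... | c≺j , Ej , ready =
      reach-target (stage-step stage c≺j Ej ready) (boundary-adjoin (site⁺ adj) bE) rest complete-F
    reach-target {F = F} stage bE (done E≗F) complete-F = stage-target stage-F all-raised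
      where
      stage-F : Stage F
      stage-F = stage-≗ E≗F stage
      all-raised : ∀ k → c ≺ k → F k ≢ D k
      all-raised k c≺k Fk with progress stage-F c≺k Fk
      ... | j , site = complete-F j (adjoinable (boundary-≗ E≗F bE) site)

    completion : ∀ {X} → Target X → IsCompletion D⁺ X
    completion {X} target =
      build (suc (deficit X D⁺)) target D⁺-stage boundary-D⁺ ≤-refl ,
      (λ j adj → target-complete target j (site⁺ adj)) ,
      (λ E reach complete-E → target-unique (reach-target D⁺-stage boundary-D⁺ reach complete-E) target)

module _ {n : ℕ} where
  open Nearest (ascending n) using (nearest-below; nearest-above)
  open Order (ascending n) using (≺⇒≢; ≺⇒≢˘)

  -- Extremality in the sense of Defs: no column on that side reaches the
  -- height of i (a column reaching it would yield a neighbour at that level).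
  left-extremal⇒ : ∀ {X : Diagram n} {i} → LeftExtremal X i → ∀ k → k Fin.< i → X k < X i
  left-extremal⇒ {X} {i} extremal k k<i with X i ≤? X k
  ... | no Xi≰Xk = ≰⇒> Xi≰Xk
  ... | yes reach with nearest-below X (X i) k<i reach
  ...   | j , _ , j<i , reach-j , btw = ⊥-elim (extremal (j , j<i , reach-j , ≤-refl , btw))

  ⇒left-extremal : ∀ {X : Diagram n} {i} → (∀ k → k Fin.< i → X k < X i) → LeftExtremal X i
  ⇒left-extremal lower (j , j<i , reach , _ , _) = <⇒≱ (lower j j<i) reach

  right-extremal⇒ : ∀ {X : Diagram n} {i} → RightExtremal X i → ∀ k → i Fin.< k → X k < X i
  right-extremal⇒ {X} {i} extremal k i<k with X i ≤? X k
  ... | no Xi≰Xk = ≰⇒> Xi≰Xk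
  ... | yes reach with nearest-above X (X i) i<k reach
  ...   | j , i<j , _ , reach-j , btw = ⊥-elim (extremal (j , i<j , ≤-refl , reach-j , btw))

  ⇒right-extremal : ∀ {X : Diagram n} {i} → (∀ k → i Fin.< k → X k < X i) → RightExtremal X i
  ⇒right-extremal upper (j , i<j , _ , reach , _) = <⇒≱ (upper j i<j) reach

  LeftEvenSite RightOddSite : Diagram n → Fin n → Set
  LeftEvenSite X j = Even (X j) × Σ (Fin n) λ m → j Fin.< m × suc (suc (X j)) ≤ X m ×
                                    (∀ q → j Fin.< q → q Fin.< m → X q ≤ X j)
  RightOddSite X j = Odd (X j) × Σ (Fin n) λ m → m Fin.< j × suc (suc (X j)) ≤ X m ×
                                    (∀ q → m Fin.< q → q Fin.< j → X q ≤ X j)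

  left-even⇒ : ∀ {X j} → LeftEvenAdjoinable X j → LeftEvenSite X j
  left-even⇒ {X} {j} (even , _ , m , (j<m , _ , _ , btw) , (_ , _ , high , _)) =
    even , m , j<m , subst (suc (suc (X j)) ≤_) (addAt-elsewhere j 2 X (≺⇒≢˘ j<m)) high ,
    λ q j<q q<m → ≤-pred (subst (_< suc (X j)) (addAt-elsewhere j 2 X (≺⇒≢˘ j<q)) (btw q j<q q<m))

  right-odd⇒ : ∀ {X j} → RightOddAdjoinable X j → RightOddSite X j
  right-odd⇒ {X} {j} (odd , _ , m , (m<j , _ , _ , btw) , (_ , high , _ , _)) =
    odd , m , m<j , subst (suc (suc (X j)) ≤_) (addAt-elsewhere j 2 X (≺⇒≢ m<j)) high ,
    λ q m<q q<j → ≤-pred (subst (_< suc (X j)) (addAt-elsewhere j 2 X (≺⇒≢ q<j)) (btw q m<q q<j))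

  ⇒left-even : ∀ {X j} → LeftEvenSite X j → BoundaryConditions (addAt j 2 X) → LeftEvenAdjoinable X j
  ⇒left-even {X} {j} (even , m , j<m , high , btw) bc =
    even , bc , m , (j<m , ≤-trans (n≤1+n _) Yj , ≤-trans (n≤1+n _) Ym , btw′) ,
                    (j<m , Yj , Ym , λ q j<q q<m → ≤-trans (btw′ q j<q q<m) (n≤1+n _))
    where
    Yj : suc (suc (X j)) ≤ addAt j 2 X j
    Yj = ≤-reflexive (sym (domino-here j X))
    Ym : suc (suc (X j)) ≤ addAt j 2 X m
    Ym = subst (suc (suc (X j)) ≤_) (sym (addAt-elsewhere j 2 X (≺⇒≢˘ j<m))) high
    btw′ : ∀ q → j Fin.< q → q Fin.< m → addAt j 2 X q < suc (X j)
    btw′ q j<q q<m = s≤s (subst (_≤ X j) (sym (addAt-elsewhere j 2 X (≺⇒≢˘ j<q))) (btw q j<q q<m))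

  ⇒right-odd : ∀ {X j} → RightOddSite X j → BoundaryConditions (addAt j 2 X) → RightOddAdjoinable X j
  ⇒right-odd {X} {j} (odd , m , m<j , high , btw) bc =
    odd , bc , m , (m<j , ≤-trans (n≤1+n _) Ym , ≤-trans (n≤1+n _) Yj , btw′) ,
                   (m<j , Ym , Yj , λ q m<q q<j → ≤-trans (btw′ q m<q q<j) (n≤1+n _))
    where
    Yj : suc (suc (X j)) ≤ addAt j 2 X j
    Yj = ≤-reflexive (sym (domino-here j X))
    Ym : suc (suc (X j)) ≤ addAt j 2 X m
    Ym = subst (suc (suc (X j)) ≤_) (sym (addAt-elsewhere j 2 X (≺⇒≢ m<j))) high
    btw′ : ∀ q → m Fin.< q → q Fin.< j → addAt j 2 X q < suc (X j)
    btw′ q m<q q<j = s≤s (subst (_≤ X j) (sym (addAt-elsewhere j 2 X (≺⇒≢ q<j))) (btw q m<q q<j))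

  faithful-ascending : Diagrams.Faithful (ascending n) evenLower
  faithful-ascending = record
    { boundary⁺ = boundary⁺ ; boundary⁻ = boundary⁻ ; site⁺ = site⁺ ; site⁻ = site⁻ }
    where
    open Diagrams (ascending n) evenLower using (Boundary; Site)
    boundary⁺ : ∀ {X} → BoundaryConditions X → Boundary X
    boundary⁺ (left , right) = (λ i → left i ∘ ⇒left-extremal) , (λ i → right i ∘ ⇒right-extremal)
    boundary⁻ : ∀ {X} → Boundary X → BoundaryConditions X
    boundary⁻ (lower , upper) = (λ i → lower i ∘ left-extremal⇒) , (λ i → upper i ∘ right-extremal⇒)
    site⁺ : ∀ {X j} → Adjoinable X j → Site X j
    site⁺ (inj₁ left-even) = inj₂ (left-even⇒ left-even)
    site⁺ (inj₂ right-odd) = inj₁ (right-odd⇒ right-odd)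
    site⁻ : ∀ {X j} → Site X j → BoundaryConditions (addAt j 2 X) → Adjoinable X j
    site⁻ (inj₁ right-odd) = inj₂ ∘ ⇒right-odd right-odd
    site⁻ (inj₂ left-even) = inj₁ ∘ ⇒left-even left-even

  faithful-descending : Diagrams.Faithful (reverse (ascending n)) (swap evenLower)
  faithful-descending = record
    { boundary⁺ = boundary⁺ ; boundary⁻ = boundary⁻ ; site⁺ = site⁺ ; site⁻ = site⁻ }
    where
    open Diagrams (reverse (ascending n)) (swap evenLower) using (Boundary; Site)
    boundary⁺ : ∀ {X} → BoundaryConditions X → Boundary X
    boundary⁺ (left , right) = (λ i → right i ∘ ⇒right-extremal) , (λ i → left i ∘ ⇒left-extremal)
    boundary⁻ : ∀ {X} → Boundary X → BoundaryConditions X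
    boundary⁻ (lower , upper) = (λ i → upper i ∘ left-extremal⇒) , (λ i → lower i ∘ right-extremal⇒)
    site⁺ : ∀ {X j} → Adjoinable X j → Site X j
    site⁺ (inj₁ left-even) with left-even⇒ left-even
    ... | even , m , j<m , high , btw = inj₁ (even , m , j<m , high , λ q q<m j<q → btw q j<q q<m)
    site⁺ (inj₂ right-odd) with right-odd⇒ right-odd
    ... | odd , m , m<j , high , btw = inj₂ (odd , m , m<j , high , λ q q<j m<q → btw q m<q q<j)
    site⁻ : ∀ {X j} → Site X j → BoundaryConditions (addAt j 2 X) → Adjoinable X j
    site⁻ (inj₁ (even , m , j<m , high , btw)) =
      inj₁ ∘ ⇒left-even (even , m , j<m , high , λ q j<q q<m → btw q q<m j<q)
    site⁻ (inj₂ (odd , m , m<j , high , btw)) =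
      inj₂ ∘ ⇒right-odd (odd , m , m<j , high , λ q m<q q<j → btw q q<j m<q)

module _ {n} (c : Fin n) (D : Diagram n) where

  dominoesRightOf-spec : ∀ k →
    (c Fin.< k → dominoesRightOf c (addAt c 1 D) k ≡ suc (suc (D k))) ×
    (¬ c Fin.< k → dominoesRightOf c (addAt c 1 D) k ≡ addAt c 1 D k)
  dominoesRightOf-spec k with c Fin.<? k
  ... | yes c<k =
    (λ _ → trans (cong (_+ 2) (addAt-elsewhere c 1 D (≺⇒≢˘ c<k))) (+-comm (D k) 2)) , λ c≮k → ⊥-elim (c≮k c<k)
    where open Order (ascending n) using (≺⇒≢˘)
  ... | no c≮k = (λ c<k → ⊥-elim (c≮k c<k)) , λ _ → refl

  dominoesLeftOf-spec : ∀ k →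
    (k Fin.< c → dominoesLeftOf c (addAt c 1 D) k ≡ suc (suc (D k))) ×
    (¬ k Fin.< c → dominoesLeftOf c (addAt c 1 D) k ≡ addAt c 1 D k)
  dominoesLeftOf-spec k with k Fin.<? c
  ... | yes k<c =
    (λ _ → trans (cong (_+ 2) (addAt-elsewhere c 1 D (≺⇒≢ k<c))) (+-comm (D k) 2)) , λ k≮c → ⊥-elim (k≮c k<c)
    where open Order (ascending n) using (≺⇒≢)
  ... | no k≮c = (λ k<c → ⊥-elim (k≮c k<c)) , λ _ → refl

-- For even r the strongly extremal column c is the rightmost column of
-- height r, and the theorem is the completion result read from left to
-- right; for odd r it is the leftmost one, and the result is read from
-- right to left with the parities exchanged.
lemma2p3p4 : ∀ {t} (D : Diagram (suc t)) (r : ℕ) (c : Fin (suc t)) →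
    BoundaryConditions D → HasHeight D r → 0 < r → Complete D →
    StronglyExtremal D r c →
    (Even r → IsCompletion (addAt c 1 D) (dominoesRightOf c (addAt c 1 D))) ×
    (Odd r → IsCompletion (addAt c 1 D) (dominoesLeftOf c (addAt c 1 D)))
lemma2p3p4 {t} D r c bc (D≤r , _) _ complete (D-c , leftmost , rightmost) =
  (λ even → Rightwards.completion even (dominoesRightOf-spec c D)) ,
  (λ odd → Leftwards.completion odd (dominoesLeftOf-spec c D))
  where
  module Rightwards (even : Even r) =
    Diagrams.Completion (ascending (suc t)) evenLower faithful-ascending
      D r c D-c D≤r (rightmost even) even bc complete
  module Leftwards (odd : Odd r) =
    Diagrams.Completion (reverse (ascending (suc t))) (swap evenLower) faithful-descending
      D r c D-c D≤r (leftmost odd) odd bc complete
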